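{- Let $p$ be a prime. Let $a,b$ be integers with $1\le b\le a$, $\nu(a-b)=0$, and $\{\nu(a),\nu(b)\}=\{0,k\}$ for some integer $k\ge0$. Let $c=a$ if $\nu(a)=k$ and $c=b$ if $\nu(b)=k$. Then the limit $\binom{ap^\infty}{bp^\infty}:=\lim_{e\to\infty}\binom{ap^e}{bp^e}$ exists in $\mathbb{Z}_p$ and $$\binom{ap^\infty}{bp^\infty}=p^{\nu\binom ab}(-1)^{pck}\frac{z_a}{z_b\,z_{a-b}}.$$
   Context: For a prime $p$ and a positive integer $n$, $\nu(n)$ denotes the exponent of $p$ in $n$ and $\mathrm{u}(n)=n/p^{\nu(n)}$ its unit part. For a positive integer $\alpha$ not divisible by $p$, $z_\alpha\in\mathbb{Z}_p$ denotes the $p$-adic limit $\lim_{e\to\infty}(-1)^{p\alpha e}\mathrm{u}((\alpha p^e)!)$ (which exists and is a $p$-adic unit). For an arbitrary positive integer $n$, $z_n:=z_{\mathrm{u}(n)}$. Limits are taken in the $p$-adic metric $d(x,y)=p^{ -\nu(x-y)}$. -}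

module Defs where

open import Data.Nat using (ℕ; zero; suc; _≤_; _*_; _^_; _∸_; _!)
open import Data.Nat.Divisibility using (_∣?_; divides)
open import Data.Integer as ℤ using (ℤ; +_; -_; _-_)
open import Data.Integer.Divisibility using () renaming (_∣_ to _∣ℤ_)
open import Data.Product using (_×_; _,_; proj₁; proj₂; ∃)
open import Relation.Nullary using (yes; no)

valUnit : ℕ → ℕ → ℕ → ℕ × ℕ
valUnit zero    p n       = 0 , n
valUnit (suc f) p zero    = 0 , 0
valUnit (suc f) p (suc m) with p ∣? suc m
... | yes (divides q _) = suc (proj₁ (valUnit f p q)) , proj₂ (valUnit f p q)
... | no _              = 0 , suc m

-- ν(n): exponent of p in n (meaningful for prime p and n ≥ 1)
ν : ℕ → ℕ → ℕ
ν p n = proj₁ (valUnit n p n)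

u : ℕ → ℕ → ℕ
u p n = proj₂ (valUnit n p n)

negOnePow : ℕ → ℤ
negOnePow zero          = + 1
negOnePow (suc zero)    = - (+ 1)
negOnePow (suc (suc n)) = negOnePow n

-- p-adic integers, as coherent sequences of approximations:
-- approx (suc n) ≡ approx n (mod p^n)
record ℤₚ (p : ℕ) : Set where
  field
    approx   : ℕ → ℤ
    coherent : ∀ n → (+ (p ^ n)) ∣ℤ (approx (suc n) - approx n)
open ℤₚ public

_⟶[_]_ : (ℕ → ℤ) → (p : ℕ) → ℤₚ p → Set
s ⟶[ p ] L = ∀ N → ∃ λ E → ∀ e → E ≤ e → (+ (p ^ N)) ∣ℤ (s e - approx L N)

PadicNull : ℕ → (ℕ → ℤ) → Set
PadicNull p s = ∀ N → ∃ λ E → ∀ e → E ≤ e → (+ (p ^ N)) ∣ℤ (s e)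

-- The sequence whose p-adic limit defines z_n = z_{u(n)}:
-- w_n(e) = (-1)^(p α e) u((α p^e)!), α = u(n)
zSeq : ℕ → ℕ → ℕ → ℤ
zSeq p n e = negOnePow (p * u p n * e) ℤ.* (+ u p ((u p n * p ^ e) !))

{-# OPTIONS --safe #-}
module Submission where

-- Write (n)!ₚ for the product of the integers in [1, n] prime to p. Splitting off the
-- multiples of p gives (p n)! = p^n · n! · (p n)!ₚ, so from e to e + 1 the valuation of
-- (α p^e)! grows by α p^e and its unit part gets multiplied by (α p^(e+1))!ₚ. Cutting
-- [1, α p^(j+1)] into blocks of length p^(j+1), Wilson's theorem and the lifting
-- x ≡ y (mod p^j) ⇒ x^p ≡ y^p (mod p^(j+1)) give (α p^(j+1))!ₚ ≡ (-1)^(pα) (mod p^j).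
-- Consequently ν(C(a p^e, b p^e)) = ν(C(a, b)) for all e, the unit parts of these
-- binomial coefficients form a coherent sequence, and comparing u((x p^e)!) with
-- u((u(x) p^e)!) in the same way produces z_a / (z_b z_(a-b)) and the sign (-1)^(pck).

open import Defs
open import Data.Bool using (Bool; true; false; if_then_else_; _∧_; _∨_)
open import Data.Bool.Properties using (∧-zeroʳ)
open import Data.Empty using (⊥-elim)
open import Data.Integer as ℤ using (ℤ; +_; -_; _-_)
open import Data.Integer.Divisibility using () renaming (_∣_ to _∣ℤ_)
import Data.Integer.Divisibility.Signed as ℤˢ
open import Data.Integer.DivMod using (_%ℕ_; _/ℕ_; a≡a%ℕn+[a/ℕn]*n; n%ℕd<d)
import Data.Integer.Properties as ℤ
open import Data.Integer.Tactic.RingSolver using (solve-∀)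
open import Data.Nat as ℕ
  using (ℕ; zero; suc; _+_; _*_; _^_; _∸_; _≤_; _<_; z≤n; s≤s; _!; _≤?_; _<?_)
open import Data.Nat.Combinatorics using (_C_; nCk≡n!/k![n-k]!; k![n∸k]!∣n!)
open import Data.Nat.Coprimality using (prime⇒coprime; coprime-Bézout)
open import Data.Nat.Divisibility
  using (_∣_; _∤_; divides; _∣?_; m∣m*n; n∣m*n; ∣m⇒∣m*n; ∣m+n∣m⇒∣n; ∣m∣n⇒∣m+n;
         ∣-refl; ∣-reflexive; ∣-trans; ∣⇒≤; *-monoʳ-∣; *-cancelˡ-∣)
open import Data.Nat.DivMod using (_/_; m*[n/m]≡n)
open import Data.Nat.GCD using (module Bézout)
open import Data.Nat.Primality using (Prime; euclidsLemma; ¬prime[0]; ¬prime[1])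
import Data.Nat.Properties as ℕ
open import Data.Nat.Properties using (_!*_!≢0)
open import Algebra.Properties.CommutativeSemigroup ℕ.*-commutativeSemigroup using (x∙yz≈y∙xz)
open import Data.Nat.Tactic.RingSolver using () renaming (solve-∀ to ℕ-solve-∀)
open import Data.Product using (Σ; ∃; _×_; _,_; proj₁; proj₂)
open import Data.Sum using (_⊎_; inj₁; inj₂)
open import Function using (_∘_)
open import Relation.Binary.Bundles using (Setoid)
open import Relation.Binary.Definitions using (tri<; tri≈; tri>)
open import Relation.Binary.PropositionalEquality
import Relation.Binary.Reasoning.Setoid as SetoidReasoning
open import Relation.Nullary using (¬_; yes; no; does)
open import Relation.Nullary.Decidable using (dec-true; dec-false)

-- Congruences of integers

infix 4 _≡_[mod_]
record _≡_[mod_] (x y : ℤ) (m : ℕ) : Set where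
  constructor mod-witness
  field
    quotient : ℤ
    equation : x ≡ y ℤ.+ quotient ℤ.* + m

module _ {m : ℕ} where

  mod-refl : ∀ {x} → x ≡ x [mod m ]
  mod-refl {x} = mod-witness (+ 0) (lemma x (+ m))
    where lemma : ∀ x m → x ≡ x ℤ.+ + 0 ℤ.* m
          lemma = solve-∀

  mod-reflexive : ∀ {x y} → x ≡ y → x ≡ y [mod m ]
  mod-reflexive refl = mod-refl

  mod-sym : ∀ {x y} → x ≡ y [mod m ] → y ≡ x [mod m ]
  mod-sym {y = y} (mod-witness q refl) = mod-witness (- q) (lemma y q (+ m))
    where lemma : ∀ y q m → y ≡ (y ℤ.+ q ℤ.* m) ℤ.+ (- q) ℤ.* m
          lemma = solve-∀

  mod-trans : ∀ {x y z} → x ≡ y [mod m ] → y ≡ z [mod m ] → x ≡ z [mod m ]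
  mod-trans {z = z} (mod-witness q refl) (mod-witness r refl) = mod-witness (r ℤ.+ q) (lemma z q r (+ m))
    where lemma : ∀ z q r m → (z ℤ.+ r ℤ.* m) ℤ.+ q ℤ.* m ≡ z ℤ.+ (r ℤ.+ q) ℤ.* m
          lemma = solve-∀

  *-cong-mod : ∀ {x x′ y y′} → x ≡ x′ [mod m ] → y ≡ y′ [mod m ] → x ℤ.* y ≡ x′ ℤ.* y′ [mod m ]
  *-cong-mod {x′ = x} {y′ = y} (mod-witness q refl) (mod-witness r refl) =
    mod-witness (q ℤ.* y ℤ.+ x ℤ.* r ℤ.+ q ℤ.* r ℤ.* + m) (lemma x y q r (+ m))
    where lemma : ∀ x y q r m → (x ℤ.+ q ℤ.* m) ℤ.* (y ℤ.+ r ℤ.* m)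
                               ≡ x ℤ.* y ℤ.+ (q ℤ.* y ℤ.+ x ℤ.* r ℤ.+ q ℤ.* r ℤ.* m) ℤ.* m
          lemma = solve-∀

  *-congˡ-mod : ∀ z {x y} → x ≡ y [mod m ] → z ℤ.* x ≡ z ℤ.* y [mod m ]
  *-congˡ-mod z = *-cong-mod (mod-refl {z})

  *-congʳ-mod : ∀ z {x y} → x ≡ y [mod m ] → x ℤ.* z ≡ y ℤ.* z [mod m ]
  *-congʳ-mod z x≡y = *-cong-mod x≡y (mod-refl {z})

  ^-cong-mod : ∀ n {x y} → x ≡ y [mod m ] → x ℤ.^ n ≡ y ℤ.^ n [mod m ]
  ^-cong-mod zero    x≡y = mod-refl
  ^-cong-mod (suc n) x≡y = *-cong-mod x≡y (^-cong-mod n x≡y)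

  mod-diff : ∀ {x y} → x ≡ y [mod m ] → x - y ≡ + 0 [mod m ]
  mod-diff {y = y} (mod-witness q refl) = mod-witness q (lemma y q (+ m))
    where lemma : ∀ y q m → (y ℤ.+ q ℤ.* m) - y ≡ + 0 ℤ.+ q ℤ.* m
          lemma = solve-∀

  mod⇒∣ : ∀ {x y} → x ≡ y [mod m ] → + m ∣ℤ (x - y)
  mod⇒∣ {y = y} (mod-witness q refl) = ℤˢ.∣⇒∣ᵤ (ℤˢ.divides q (lemma y q (+ m)))
    where lemma : ∀ y q m → (y ℤ.+ q ℤ.* m) - y ≡ q ℤ.* m
          lemma = solve-∀

  ∣⇒mod : ∀ {x y} → + m ∣ℤ (x - y) → x ≡ y [mod m ]
  ∣⇒mod {x} {y} m∣x-y with ℤˢ.∣ᵤ⇒∣ m∣x-y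
  ... | ℤˢ.divides q eq = mod-witness q (trans (lemma x y) (cong (λ t → y ℤ.+ t) eq))
    where lemma : ∀ x y → x ≡ y ℤ.+ (x - y)
          lemma = solve-∀

  mod-setoid : Setoid _ _
  mod-setoid = record
    { Carrier = ℤ
    ; _≈_ = _≡_[mod m ]
    ; isEquivalence = record { refl = mod-refl ; sym = mod-sym ; trans = mod-trans }
    }

mod-weaken : ∀ {m n x y} → m ∣ n → x ≡ y [mod n ] → x ≡ y [mod m ]
mod-weaken {m} {y = y} (divides k refl) (mod-witness q refl) =
  mod-witness (q ℤ.* + k) (cong (λ t → y ℤ.+ t) (trans (cong (λ t → q ℤ.* t) (ℤ.pos-* k m)) (sym (ℤ.*-assoc q (+ k) (+ m)))))

mod-one : ∀ x y → x ≡ y [mod 1 ]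
mod-one x y = mod-witness (x - y) (lemma x y)
  where lemma : ∀ x y → x ≡ y ℤ.+ (x - y) ℤ.* + 1
        lemma = solve-∀

mod⇒∣∸ : ∀ {m a b} → a ≤ b → + a ≡ + b [mod m ] → m ∣ b ∸ a
mod⇒∣∸ {m} {a} {b} a≤b a≡b = subst (m ∣_) ∣a-b∣≡b∸a (mod⇒∣ a≡b)
  where ∣a-b∣≡b∸a : ℤ.∣ + a - + b ∣ ≡ b ∸ a
        ∣a-b∣≡b∸a = trans (cong ℤ.∣_∣ (ℤ.m-n≡m⊖n a b)) (ℤ.∣⊖∣-≤ a≤b)

multiple+-mod : ∀ {n s} t → n ∣ s → + (s + t) ≡ + t [mod n ]
multiple+-mod {n} t (divides k refl) =
  mod-witness (+ k) (trans (ℤ.pos-+ (k * n) t) (trans (ℤ.+-comm (+ (k * n)) (+ t)) (cong (λ u → + t ℤ.+ u) (ℤ.pos-* k n))))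

binomial-first-order : ∀ n (y d : ℤ) → ∃ λ q →
  (y ℤ.+ d) ℤ.^ suc n ≡ y ℤ.^ suc n ℤ.+ + suc n ℤ.* y ℤ.^ n ℤ.* d ℤ.+ d ℤ.* d ℤ.* q
binomial-first-order zero y d = + 0 , lemma y d
  where lemma : ∀ y d → (y ℤ.+ d) ℤ.* + 1 ≡ y ℤ.* + 1 ℤ.+ + 1 ℤ.* + 1 ℤ.* d ℤ.+ d ℤ.* d ℤ.* + 0
        lemma = solve-∀
binomial-first-order (suc n) y d with binomial-first-order n y d
... | q , eq = y ℤ.* q ℤ.+ + suc n ℤ.* y ℤ.^ n ℤ.+ d ℤ.* q ,
  trans (cong ((y ℤ.+ d) ℤ.*_) eq) (lemma y d (y ℤ.^ n) (+ suc n) q)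
  where lemma : ∀ y d yⁿ k q → (y ℤ.+ d) ℤ.* (y ℤ.* yⁿ ℤ.+ k ℤ.* yⁿ ℤ.* d ℤ.+ d ℤ.* d ℤ.* q)
                 ≡ y ℤ.* (y ℤ.* yⁿ) ℤ.+ (+ 1 ℤ.+ k) ℤ.* (y ℤ.* yⁿ) ℤ.* d ℤ.+ d ℤ.* d ℤ.* (y ℤ.* q ℤ.+ k ℤ.* yⁿ ℤ.+ d ℤ.* q)
        lemma = solve-∀

^-lift-mod : ∀ n m {x y} → x ≡ y [mod suc n * m ] → x ℤ.^ suc n ≡ y ℤ.^ suc n [mod suc n * (suc n * m) ]
^-lift-mod n m {y = y} (mod-witness q refl) = mod-witness Q (begin
  (y ℤ.+ q ℤ.* + (k * m)) ℤ.^ suc n                       ≡⟨ cong (λ t → (y ℤ.+ q ℤ.* t) ℤ.^ suc n) km≡K*M ⟩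
  (y ℤ.+ d) ℤ.^ suc n                                     ≡⟨ proj₂ (binomial-first-order n y d) ⟩
  y ℤ.^ suc n ℤ.+ K ℤ.* y ℤ.^ n ℤ.* d ℤ.+ d ℤ.* d ℤ.* r  ≡⟨ lemma (y ℤ.^ suc n) (y ℤ.^ n) q r K M ⟩
  y ℤ.^ suc n ℤ.+ Q ℤ.* (K ℤ.* (K ℤ.* M))                ≡⟨ cong (λ t → y ℤ.^ suc n ℤ.+ Q ℤ.* t) kkm≡K*K*M ⟨
  y ℤ.^ suc n ℤ.+ Q ℤ.* + (k * (k * m))                   ∎)
  where
  open ≡-Reasoning
  k = suc n
  K = + k
  M = + m
  d = q ℤ.* (K ℤ.* M)
  r = proj₁ (binomial-first-order n y d)
  Q = y ℤ.^ n ℤ.* q ℤ.+ q ℤ.* q ℤ.* r ℤ.* M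
  km≡K*M : + (k * m) ≡ K ℤ.* M
  km≡K*M = ℤ.pos-* k m
  kkm≡K*K*M : + (k * (k * m)) ≡ K ℤ.* (K ℤ.* M)
  kkm≡K*K*M = trans (ℤ.pos-* k (k * m)) (cong (K ℤ.*_) km≡K*M)
  lemma : ∀ yⁿ⁺¹ yⁿ q r K M → yⁿ⁺¹ ℤ.+ K ℤ.* yⁿ ℤ.* (q ℤ.* (K ℤ.* M)) ℤ.+ q ℤ.* (K ℤ.* M) ℤ.* (q ℤ.* (K ℤ.* M)) ℤ.* r
                            ≡ yⁿ⁺¹ ℤ.+ (yⁿ ℤ.* q ℤ.+ q ℤ.* q ℤ.* r ℤ.* M) ℤ.* (K ℤ.* (K ℤ.* M))
  lemma = solve-∀

-- Signs

negOnePow-suc : ∀ n → negOnePow (suc n) ≡ - negOnePow n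
negOnePow-suc zero          = refl
negOnePow-suc (suc zero)    = refl
negOnePow-suc (suc (suc n)) = negOnePow-suc n

negOnePow-+ : ∀ m n → negOnePow (m + n) ≡ negOnePow m ℤ.* negOnePow n
negOnePow-+ zero    n = sym (ℤ.*-identityˡ (negOnePow n))
negOnePow-+ (suc m) n = begin
  negOnePow (suc m + n)              ≡⟨ negOnePow-suc (m + n) ⟩
  - negOnePow (m + n)                ≡⟨ cong -_ (negOnePow-+ m n) ⟩
  - (negOnePow m ℤ.* negOnePow n)    ≡⟨ ℤ.neg-distribˡ-* (negOnePow m) (negOnePow n) ⟩
  - negOnePow m ℤ.* negOnePow n      ≡⟨ cong (λ s → s ℤ.* negOnePow n) (negOnePow-suc m) ⟨
  negOnePow (suc m) ℤ.* negOnePow n  ∎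
  where open ≡-Reasoning

negOnePow-square : ∀ n → negOnePow n ℤ.* negOnePow n ≡ + 1
negOnePow-square zero          = refl
negOnePow-square (suc zero)    = refl
negOnePow-square (suc (suc n)) = negOnePow-square n

negOnePow-^ : ∀ m n → negOnePow m ℤ.^ n ≡ negOnePow (m * n)
negOnePow-^ m zero    = cong negOnePow (sym (ℕ.*-zeroʳ m))
negOnePow-^ m (suc n) = begin
  negOnePow m ℤ.* negOnePow m ℤ.^ n      ≡⟨ cong (negOnePow m ℤ.*_) (negOnePow-^ m n) ⟩
  negOnePow m ℤ.* negOnePow (m * n)     ≡⟨ negOnePow-+ m (m * n) ⟨
  negOnePow (m + m * n)                 ≡⟨ cong negOnePow (ℕ.*-suc m n) ⟨
  negOnePow (m * suc n)                 ∎
  where open ≡-Reasoning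

negOnePow-*-self : ∀ n → negOnePow (n * n) ≡ negOnePow n
negOnePow-*-self zero    = refl
negOnePow-*-self (suc n) = begin
  negOnePow (suc n * suc n)
    ≡⟨ cong (λ t → negOnePow (suc (n + t))) (ℕ.*-suc n n) ⟩
  negOnePow (suc n + (n + n * n))
    ≡⟨ negOnePow-+ (suc n) (n + n * n) ⟩
  negOnePow (suc n) ℤ.* negOnePow (n + n * n)
    ≡⟨ cong (negOnePow (suc n) ℤ.*_) (negOnePow-+ n (n * n)) ⟩
  negOnePow (suc n) ℤ.* (negOnePow n ℤ.* negOnePow (n * n))
    ≡⟨ cong (λ t → negOnePow (suc n) ℤ.* (negOnePow n ℤ.* t)) (negOnePow-*-self n) ⟩
  negOnePow (suc n) ℤ.* (negOnePow n ℤ.* negOnePow n)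
    ≡⟨ cong (negOnePow (suc n) ℤ.*_) (negOnePow-square n) ⟩
  negOnePow (suc n) ℤ.* + 1
    ≡⟨ ℤ.*-identityʳ _ ⟩
  negOnePow (suc n) ∎
  where open ≡-Reasoning

negOnePow-*-^ : ∀ n k m → negOnePow (n * (n ^ k * m)) ≡ negOnePow (n * m)
negOnePow-*-^ n zero    m = cong (λ t → negOnePow (n * t)) (ℕ.*-identityˡ m)
negOnePow-*-^ n (suc k) m = begin
  negOnePow (n * (n * n ^ k * m))     ≡⟨ cong negOnePow (lemma n (n ^ k) m) ⟩
  negOnePow (n * n * (n ^ k * m))     ≡⟨ negOnePow-^ (n * n) (n ^ k * m) ⟨
  negOnePow (n * n) ℤ.^ (n ^ k * m)   ≡⟨ cong (ℤ._^ (n ^ k * m)) (negOnePow-*-self n) ⟩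
  negOnePow n ℤ.^ (n ^ k * m)         ≡⟨ negOnePow-^ n (n ^ k * m) ⟩
  negOnePow (n * (n ^ k * m))         ≡⟨ negOnePow-*-^ n k m ⟩
  negOnePow (n * m)                   ∎
  where
  open ≡-Reasoning
  lemma : ∀ a b c → a * (a * b * c) ≡ a * a * (b * c)
  lemma = ℕ-solve-∀

negOnePow-*0 : ∀ n → negOnePow (n * 0) ≡ + 1
negOnePow-*0 n = cong negOnePow (ℕ.*-zeroʳ n)

negOnePow-valuations : ∀ p {a b c k i j} → (i ≡ 0 × j ≡ k) ⊎ (i ≡ k × j ≡ 0) → (i ≡ k × c ≡ a) ⊎ (j ≡ k × c ≡ b) →
  negOnePow (p * b * j) ≡ negOnePow (p * c * k) ℤ.* negOnePow (p * a * i)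
negOnePow-valuations p {a} {b} (inj₁ (refl , refl)) (inj₁ (refl , refl)) =
  trans (negOnePow-*0 (p * b)) (sym (cong₂ ℤ._*_ (negOnePow-*0 (p * a)) (negOnePow-*0 (p * a))))
negOnePow-valuations p {a} {b} {k = k} (inj₁ (refl , refl)) (inj₂ (_ , refl)) =
  sym (trans (cong (negOnePow (p * b * k) ℤ.*_) (negOnePow-*0 (p * a))) (ℤ.*-identityʳ _))
negOnePow-valuations p {a} {b} {k = k} (inj₂ (refl , refl)) (inj₁ (_ , refl)) =
  trans (negOnePow-*0 (p * b)) (sym (negOnePow-square (p * a * k)))
negOnePow-valuations p {a} {b} (inj₂ (refl , refl)) (inj₂ (refl , refl)) =
  sym (trans (cong (negOnePow (p * b * 0) ℤ.*_) (negOnePow-*0 (p * a))) (ℤ.*-identityʳ _))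

*-negOnePow-involutive : ∀ x n → x ℤ.* negOnePow n ℤ.* negOnePow n ≡ x
*-negOnePow-involutive x n = begin
  x ℤ.* negOnePow n ℤ.* negOnePow n      ≡⟨ ℤ.*-assoc x (negOnePow n) (negOnePow n) ⟩
  x ℤ.* (negOnePow n ℤ.* negOnePow n)    ≡⟨ cong (x ℤ.*_) (negOnePow-square n) ⟩
  x ℤ.* + 1                              ≡⟨ ℤ.*-identityʳ x ⟩
  x                                      ∎
  where open ≡-Reasoning

*-cancelʳ-negOnePow-mod : ∀ {m x y} n → x ℤ.* negOnePow n ≡ y ℤ.* negOnePow n [mod m ] → x ≡ y [mod m ]
*-cancelʳ-negOnePow-mod {x = x} {y} n xσ≡yσ = begin
  x                                  ≡⟨ *-negOnePow-involutive x n ⟨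
  x ℤ.* negOnePow n ℤ.* negOnePow n  ≈⟨ *-congʳ-mod (negOnePow n) xσ≡yσ ⟩
  y ℤ.* negOnePow n ℤ.* negOnePow n  ≡⟨ *-negOnePow-involutive y n ⟩
  y                                  ∎
  where open SetoidReasoning mod-setoid

-- Limits of coherent sequences

^∣^+ : ∀ m e t → m ^ e ∣ m ^ (e + t)
^∣^+ m e t = subst (m ^ e ∣_) (sym (ℕ.^-distribˡ-+-* m e t)) (m∣m*n (m ^ t))

^∣^ : ∀ m {e f} → e ≤ f → m ^ e ∣ m ^ f
^∣^ m {e} e≤f = subst (λ f → m ^ e ∣ m ^ f) (ℕ.m+[n∸m]≡n e≤f) (^∣^+ m e _)

module _ {p : ℕ} (s : ℕ → ℤ) (coherent-s : ∀ e → s (suc e) ≡ s e [mod p ^ e ]) where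

  coherentLimit : ℤₚ p
  coherentLimit = record { approx = s ; coherent = λ e → mod⇒∣ (coherent-s e) }

  coherent-stable : ∀ N t → s (N + t) ≡ s N [mod p ^ N ]
  coherent-stable N zero    = mod-reflexive (cong s (ℕ.+-identityʳ N))
  coherent-stable N (suc t) = begin
    s (N + suc t)  ≡⟨ cong s (ℕ.+-suc N t) ⟩
    s (suc (N + t)) ≈⟨ mod-weaken (^∣^+ p N t) (coherent-s (N + t)) ⟩
    s (N + t)      ≈⟨ coherent-stable N t ⟩
    s N            ∎
    where open SetoidReasoning mod-setoid

  ⟶-coherentLimit : s ⟶[ p ] coherentLimit
  ⟶-coherentLimit N = N , λ e N≤e →
    subst (λ e → + (p ^ N) ∣ℤ (s e - s N)) (ℕ.m+[n∸m]≡n N≤e) (mod⇒∣ (coherent-stable N (e ∸ N)))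

padicNull : ∀ {p} {s : ℕ → ℤ} → (∀ e → s e ≡ + 0 [mod p ^ e ]) → PadicNull p s
padicNull {p} {s} s≡0 N = N , λ e N≤e →
  subst (+ (p ^ N) ∣ℤ_) (ℤ.+-identityʳ (s e)) (mod⇒∣ (mod-weaken (^∣^ p N≤e) (s≡0 e)))

module _ (p′ : ℕ) (p-prime : Prime (suc (suc p′))) where

  private
    p : ℕ
    p = suc (suc p′)

  -- Valuations and unit parts

  record Decomposition (n i w : ℕ) : Set where
    constructor decomposition
    field
      product : p ^ i * w ≡ n
      p∤unit  : p ∤ w
  open Decomposition

  p∤1 : p ∤ 1
  p∤1 (divides (suc _) ())

  p∤* : ∀ {w v} → p ∤ w → p ∤ v → p ∤ w * v
  p∤* p∤w p∤v p∣wv with euclidsLemma _ _ p-prime p∣wv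
  ... | inj₁ p∣w = p∤w p∣w
  ... | inj₂ p∣v = p∤v p∣v

  valUnit-decomposition : ∀ fuel n → 1 ≤ n → n ≤ fuel →
    Decomposition n (proj₁ (valUnit fuel p n)) (proj₂ (valUnit fuel p n))
  valUnit-decomposition (suc fuel) (suc m) _ m<fuel with p ∣? suc m
  ... | no p∤n = decomposition (ℕ.+-identityʳ (suc m)) p∤n
  ... | yes (divides zero ())
  ... | yes (divides (suc q′) n≡qp) = decomposition product′ (p∤unit q-decomposition)
    where
    q = suc q′
    q<n : q < suc m
    q<n = subst (q <_) (sym n≡qp) (ℕ.m<m*n q p (s≤s (s≤s z≤n)))
    q-decomposition = valUnit-decomposition fuel q (s≤s z≤n) (ℕ.≤-trans (ℕ.≤-pred q<n) (ℕ.≤-pred m<fuel))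
    product′ : p ^ suc (proj₁ (valUnit fuel p q)) * proj₂ (valUnit fuel p q) ≡ suc m
    product′ = begin
      p * p ^ proj₁ (valUnit fuel p q) * proj₂ (valUnit fuel p q)   ≡⟨ ℕ.*-assoc p (p ^ proj₁ (valUnit fuel p q)) _ ⟩
      p * (p ^ proj₁ (valUnit fuel p q) * proj₂ (valUnit fuel p q)) ≡⟨ cong (p *_) (product q-decomposition) ⟩
      p * q                                                          ≡⟨ ℕ.*-comm p q ⟩
      q * p                                                          ≡⟨ n≡qp ⟨
      suc m                                                          ∎
      where open ≡-Reasoning

  ν-u-decomposition : ∀ n → 1 ≤ n → Decomposition n (ν p n) (u p n)
  ν-u-decomposition n 1≤n = valUnit-decomposition n n 1≤n ℕ.≤-refl

  p∣p^suc* : ∀ j v → p ∣ p ^ suc j * v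
  p∣p^suc* j v = ∣m⇒∣m*n v (m∣m*n (p ^ j))

  p^*-injective : ∀ i j {w v} → p ∤ w → p ∤ v → p ^ i * w ≡ p ^ j * v → i ≡ j × w ≡ v
  p^*-injective zero    zero    _   _   eq = refl , trans (sym (ℕ.*-identityˡ _)) (trans eq (ℕ.*-identityˡ _))
  p^*-injective zero    (suc j) p∤w _   eq = ⊥-elim (p∤w (subst (p ∣_) (trans (sym eq) (ℕ.*-identityˡ _)) (p∣p^suc* j _)))
  p^*-injective (suc i) zero    _   p∤v eq = ⊥-elim (p∤v (subst (p ∣_) (trans eq (ℕ.*-identityˡ _)) (p∣p^suc* i _)))
  p^*-injective (suc i) (suc j) {w} {v} p∤w p∤v eq
    with p^*-injective i j p∤w p∤v (ℕ.*-cancelˡ-≡ _ _ p (trans (sym (ℕ.*-assoc p (p ^ i) w)) (trans eq (ℕ.*-assoc p (p ^ j) v))))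
  ... | refl , w≡v = refl , w≡v

  decomposition-unique : ∀ {n i w j v} → Decomposition n i w → Decomposition n j v → i ≡ j × w ≡ v
  decomposition-unique {i = i} {j = j} (decomposition eq₁ p∤w) (decomposition eq₂ p∤v) =
    p^*-injective i j p∤w p∤v (trans eq₁ (sym eq₂))

  decomposition-positive : ∀ {n i w} → Decomposition n i w → 1 ≤ n
  decomposition-positive {w = zero}  (decomposition _  p∤0) = ⊥-elim (p∤0 (divides 0 refl))
  decomposition-positive {i = i} {w = suc w} (decomposition refl _) =
    ℕ.*-mono-≤ (ℕ.m^n>0 p i) (s≤s (z≤n {w}))

  decomposition⇒ν,u : ∀ {n i w} → Decomposition n i w → ν p n ≡ i × u p n ≡ w
  decomposition⇒ν,u d = decomposition-unique (ν-u-decomposition _ (decomposition-positive d)) d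

  unit-decomposition : ∀ {w} → p ∤ w → Decomposition w 0 w
  unit-decomposition p∤w = decomposition (ℕ.*-identityˡ _) p∤w

  decomposition-* : ∀ {m i w n j v} → Decomposition m i w → Decomposition n j v → Decomposition (m * n) (i + j) (w * v)
  decomposition-* {m} {i} {w} {n} {j} {v} (decomposition refl p∤w) (decomposition refl p∤v) =
    decomposition product′ (p∤* p∤w p∤v)
    where
    product′ : p ^ (i + j) * (w * v) ≡ p ^ i * w * (p ^ j * v)
    product′ = begin
      p ^ (i + j) * (w * v)      ≡⟨ cong (_* (w * v)) (ℕ.^-distribˡ-+-* p i j) ⟩
      p ^ i * p ^ j * (w * v)    ≡⟨ lemma (p ^ i) (p ^ j) w v ⟩
      p ^ i * w * (p ^ j * v)    ∎
      where
      open ≡-Reasoning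
      lemma : ∀ a b c d → a * b * (c * d) ≡ a * c * (b * d)
      lemma = ℕ-solve-∀

  decomposition-p^* : ∀ k {n i w} → Decomposition n i w → Decomposition (p ^ k * n) (k + i) w
  decomposition-p^* k {i = i} {w} (decomposition refl p∤w) =
    decomposition (trans (cong (_* w) (ℕ.^-distribˡ-+-* p k i)) (ℕ.*-assoc (p ^ k) (p ^ i) w)) p∤w

  -- Factorials

  keepCoprime : ℕ → ℕ
  keepCoprime m = if does (p ∣? m) then 1 else m

  keepCoprime-∣ : ∀ {m} → p ∣ m → keepCoprime m ≡ 1
  keepCoprime-∣ {m} p∣m rewrite dec-true (p ∣? m) p∣m = refl

  keepCoprime-∤ : ∀ {m} → p ∤ m → keepCoprime m ≡ m
  keepCoprime-∤ {m} p∤m rewrite dec-false (p ∣? m) p∤m = refl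

  p∤keepCoprime : ∀ m → p ∤ keepCoprime m
  p∤keepCoprime m with p ∣? m
  ... | yes p∣m = subst (p ∤_) (sym (keepCoprime-∣ p∣m)) p∤1
  ... | no  p∤m = subst (p ∤_) (sym (keepCoprime-∤ p∤m)) p∤m

  coprimeFactorial : ℕ → ℕ
  coprimeFactorial zero    = 1
  coprimeFactorial (suc n) = keepCoprime (suc n) * coprimeFactorial n

  p∤coprimeFactorial : ∀ n → p ∤ coprimeFactorial n
  p∤coprimeFactorial zero    = p∤1
  p∤coprimeFactorial (suc n) = p∤* (p∤keepCoprime (suc n)) (p∤coprimeFactorial n)

  p∤p*n+suc : ∀ n {t} → t ≤ p′ → p ∤ p * n + suc t
  p∤p*n+suc n {t} t≤p′ p∣ = ℕ.<-irrefl refl (ℕ.≤-trans (ℕ.≤-pred (∣⇒≤ (∣m+n∣m⇒∣n p∣ (m∣m*n n)))) t≤p′)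

  factorial-split : ∀ n t → t ≤ suc p′ → (p * n + t) ! ≡ p ^ n * n ! * coprimeFactorial (p * n + t)
  factorial-split zero zero _ rewrite ℕ.*-zeroʳ p = refl
  factorial-split n (suc t) t<p = begin
    (p * n + suc t) !
      ≡⟨ cong _! (ℕ.+-suc (p * n) t) ⟩
    suc (p * n + t) * (p * n + t) !
      ≡⟨ cong (suc (p * n + t) *_) (factorial-split n t (ℕ.m≤n⇒m≤1+n (ℕ.≤-pred t<p))) ⟩
    suc (p * n + t) * (p ^ n * n ! * coprimeFactorial (p * n + t))
      ≡⟨ x∙yz≈y∙xz (suc (p * n + t)) (p ^ n * n !) _ ⟩
    p ^ n * n ! * (suc (p * n + t) * coprimeFactorial (p * n + t))
      ≡⟨ cong (λ k → p ^ n * n ! * (k * coprimeFactorial (p * n + t))) (keepCoprime-∤ p∤) ⟨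
    p ^ n * n ! * coprimeFactorial (suc (p * n + t))
      ≡⟨ cong (λ m → p ^ n * n ! * coprimeFactorial m) (ℕ.+-suc (p * n) t) ⟨
    p ^ n * n ! * coprimeFactorial (p * n + suc t) ∎
    where
    open ≡-Reasoning
    p∤ : p ∤ suc (p * n + t)
    p∤ = subst (p ∤_) (ℕ.+-suc (p * n) t) (p∤p*n+suc n (ℕ.≤-pred t<p))
  factorial-split (suc n) zero _ = begin
    (p * suc n + 0) !
      ≡⟨ cong _! p*[1+n] ⟩
    suc m * m !
      ≡⟨ cong (suc m *_) (factorial-split n (suc p′) ℕ.≤-refl) ⟩
    suc m * (p ^ n * n ! * coprimeFactorial m)
      ≡⟨ cong (λ k → k * (p ^ n * n ! * coprimeFactorial m)) p*[1+n] ⟨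
    (p * suc n + 0) * (p ^ n * n ! * coprimeFactorial m)
      ≡⟨ lemma p n (p ^ n) (n !) (coprimeFactorial m) ⟩
    p ^ suc n * suc n ! * (1 * coprimeFactorial m)
      ≡⟨ cong (λ k → p ^ suc n * suc n ! * (k * coprimeFactorial m)) (keepCoprime-∣ p∣) ⟨
    p ^ suc n * suc n ! * coprimeFactorial (suc m)
      ≡⟨ cong (λ k → p ^ suc n * suc n ! * coprimeFactorial k) p*[1+n] ⟨
    p ^ suc n * suc n ! * coprimeFactorial (p * suc n + 0) ∎
    where
    open ≡-Reasoning
    m = p * n + suc p′
    p*[1+n] : p * suc n + 0 ≡ suc m
    p*[1+n] = trans (ℕ.+-identityʳ _) (trans (ℕ.*-suc p n) (trans (ℕ.+-comm p (p * n)) (ℕ.+-suc (p * n) (suc p′))))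
    p∣ : p ∣ suc m
    p∣ = subst (p ∣_) p*[1+n] (divides (suc n) (trans (ℕ.+-identityʳ _) (ℕ.*-comm p (suc n))))
    lemma : ∀ p n a b c → (p * suc n + 0) * (a * b * c) ≡ p * a * (suc n * b) * (1 * c)
    lemma = ℕ-solve-∀

  factorial-p* : ∀ n → (p * n) ! ≡ p ^ n * (n ! * coprimeFactorial (p * n))
  factorial-p* n = begin
    (p * n) !                                  ≡⟨ cong _! (ℕ.+-identityʳ (p * n)) ⟨
    (p * n + 0) !                              ≡⟨ factorial-split n 0 z≤n ⟩
    p ^ n * n ! * coprimeFactorial (p * n + 0) ≡⟨ cong (λ m → p ^ n * n ! * coprimeFactorial m) (ℕ.+-identityʳ (p * n)) ⟩
    p ^ n * n ! * coprimeFactorial (p * n)     ≡⟨ ℕ.*-assoc (p ^ n) (n !) _ ⟩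
    p ^ n * (n ! * coprimeFactorial (p * n))   ∎
    where open ≡-Reasoning

  decomposition-factorial-p* : ∀ {n i w} → Decomposition (n !) i w →
    Decomposition ((p * n) !) (n + i) (w * coprimeFactorial (p * n))
  decomposition-factorial-p* {n} {i} {w} d =
    subst₂ (λ m j → Decomposition m (n + j) (w * coprimeFactorial (p * n))) (sym (factorial-p* n)) (ℕ.+-identityʳ i)
      (decomposition-p^* n (decomposition-* d (unit-decomposition (p∤coprimeFactorial (p * n)))))

  unitFactorial : ℕ → ℕ → ℕ
  unitFactorial α e = u p ((α * p ^ e) !)

  factorial-decomposition : ∀ α e → Decomposition ((α * p ^ e) !) (ν p ((α * p ^ e) !)) (unitFactorial α e)
  factorial-decomposition α e = ν-u-decomposition _ (ℕ.1≤n! (α * p ^ e))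

  *-p^suc : ∀ α e → α * p ^ suc e ≡ p * (α * p ^ e)
  *-p^suc α e = x∙yz≈y∙xz α p (p ^ e)

  ν,unitFactorial-suc : ∀ α e →
    ν p ((α * p ^ suc e) !) ≡ α * p ^ e + ν p ((α * p ^ e) !)
    × unitFactorial α (suc e) ≡ unitFactorial α e * coprimeFactorial (α * p ^ suc e)
  ν,unitFactorial-suc α e rewrite *-p^suc α e =
    decomposition⇒ν,u (decomposition-factorial-p* {α * p ^ e} (factorial-decomposition α e))

  ν-factorial-suc : ∀ α e → ν p ((α * p ^ suc e) !) ≡ α * p ^ e + ν p ((α * p ^ e) !)
  ν-factorial-suc α e = proj₁ (ν,unitFactorial-suc α e)

  unitFactorial-suc : ∀ α e → unitFactorial α (suc e) ≡ unitFactorial α e * coprimeFactorial (α * p ^ suc e)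
  unitFactorial-suc α e = proj₂ (ν,unitFactorial-suc α e)

  -- Wilson's theorem

  productWhere : (ℕ → Bool) → ℕ → ℕ
  productWhere f zero    = 1
  productWhere f (suc n) = (if f (suc n) then suc n else 1) * productWhere f n

  productWhere-cong : ∀ {f g} n → (∀ {i} → 1 ≤ i → i ≤ n → f i ≡ g i) → productWhere f n ≡ productWhere g n
  productWhere-cong zero    _   = refl
  productWhere-cong (suc n) f≗g =
    cong₂ (λ b r → (if b then suc n else 1) * r) (f≗g (s≤s z≤n) ℕ.≤-refl)
          (productWhere-cong n (λ 1≤i i≤n → f≗g 1≤i (ℕ.m≤n⇒m≤1+n i≤n)))

  productWhere-false : ∀ n → productWhere (λ _ → false) n ≡ 1
  productWhere-false zero    = refl
  productWhere-false (suc n) = trans (ℕ.+-identityʳ _) (productWhere-false n)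

  productWhere-true : ∀ n → productWhere (λ _ → true) n ≡ n !
  productWhere-true zero    = refl
  productWhere-true (suc n) = cong (suc n *_) (productWhere-true n)

  productWhere-insert : ∀ {f g} n {y} → 1 ≤ y → y ≤ n → f y ≡ false → g y ≡ true →
    (∀ {i} → 1 ≤ i → i ≤ n → i ≢ y → f i ≡ g i) → productWhere g n ≡ y * productWhere f n
  productWhere-insert zero (s≤s _) ()
  productWhere-insert {f} {g} (suc n) {y} 1≤y y≤1+n fy gy f≗g with y ℕ.≟ suc n
  ... | yes refl rewrite fy | gy =
    cong (suc n *_) (trans (productWhere-cong n (λ 1≤i i≤n → sym (f≗g 1≤i (ℕ.m≤n⇒m≤1+n i≤n) (ℕ.<⇒≢ (s≤s i≤n)))))
                           (sym (ℕ.+-identityʳ _)))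
  ... | no y≢1+n = begin
    (if g (suc n) then suc n else 1) * productWhere g n
      ≡⟨ cong (λ b → (if b then suc n else 1) * productWhere g n) (f≗g (s≤s z≤n) ℕ.≤-refl (y≢1+n ∘ sym)) ⟨
    (if f (suc n) then suc n else 1) * productWhere g n
      ≡⟨ cong ((if f (suc n) then suc n else 1) *_) (productWhere-insert n 1≤y y≤n fy gy (λ 1≤i i≤n → f≗g 1≤i (ℕ.m≤n⇒m≤1+n i≤n))) ⟩
    (if f (suc n) then suc n else 1) * (y * productWhere f n)
      ≡⟨ x∙yz≈y∙xz (if f (suc n) then suc n else 1) y (productWhere f n) ⟩
    y * ((if f (suc n) then suc n else 1) * productWhere f n) ∎
    where
    open ≡-Reasoning
    y≤n : y ≤ n
    y≤n = ℕ.≤-pred (ℕ.≤∧≢⇒< y≤1+n y≢1+n)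

  ∣-<⇒≡0 : ∀ {d} → p ∣ d → d < p → d ≡ 0
  ∣-<⇒≡0 {zero}  _   _   = refl
  ∣-<⇒≡0 {suc d} p∣d d<p = ⊥-elim (ℕ.<-irrefl refl (ℕ.<-≤-trans d<p (∣⇒≤ p∣d)))

  mod-p-injective : ∀ {a b} → a < p → b < p → + a ≡ + b [mod p ] → a ≡ b
  mod-p-injective {a} {b} a<p b<p a≡b with ℕ.≤-total a b
  ... | inj₁ a≤b = ℕ.≤-antisym a≤b (ℕ.m∸n≡0⇒m≤n (∣-<⇒≡0 (mod⇒∣∸ a≤b a≡b) (ℕ.≤-<-trans (ℕ.m∸n≤m b a) b<p)))
  ... | inj₂ b≤a = ℕ.≤-antisym (ℕ.m∸n≡0⇒m≤n (∣-<⇒≡0 (mod⇒∣∸ b≤a (mod-sym a≡b)) (ℕ.≤-<-trans (ℕ.m∸n≤m a b) a<p))) b≤a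

  0≢1-mod-p : ¬ (+ 0 ≡ + 1 [mod p ])
  0≢1-mod-p 0≡1 with mod-p-injective {0} {1} (s≤s z≤n) (s≤s (s≤s z≤n)) 0≡1
  ... | ()

  bézout⇒inverse : ∀ {x} → Bézout.Identity 1 p x → ∃ λ y → + x ℤ.* y ≡ + 1 [mod p ]
  bézout⇒inverse {x} (Bézout.-+ a b 1+ap≡bx) = + b , mod-witness (+ a) (begin
    + x ℤ.* + b            ≡⟨ ℤ.pos-* x b ⟨
    + (x * b)              ≡⟨ cong +_ (trans (ℕ.*-comm x b) (sym 1+ap≡bx)) ⟩
    + (1 + a * p)          ≡⟨ cong (λ t → + 1 ℤ.+ t) (ℤ.pos-* a p) ⟩
    + 1 ℤ.+ + a ℤ.* + p    ∎)
    where open ≡-Reasoning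
  bézout⇒inverse {x} (Bézout.+- a b 1+bx≡ap) = - + b , mod-witness (- + a) (begin
    + x ℤ.* - + b                  ≡⟨ lemma₁ (+ x) (+ b) ⟩
    + 1 - (+ 1 ℤ.+ + b ℤ.* + x)    ≡⟨ cong (λ t → + 1 - t) 1+bx≡apℤ ⟩
    + 1 - + a ℤ.* + p              ≡⟨ lemma₂ (+ a) (+ p) ⟩
    + 1 ℤ.+ - + a ℤ.* + p          ∎)
    where
    open ≡-Reasoning
    1+bx≡apℤ : + 1 ℤ.+ + b ℤ.* + x ≡ + a ℤ.* + p
    1+bx≡apℤ = trans (cong (λ t → + 1 ℤ.+ t) (sym (ℤ.pos-* b x))) (trans (cong +_ 1+bx≡ap) (ℤ.pos-* a p))
    lemma₁ : ∀ x b → x ℤ.* - b ≡ + 1 - (+ 1 ℤ.+ b ℤ.* x)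
    lemma₁ = solve-∀
    lemma₂ : ∀ a p → + 1 - a ℤ.* p ≡ + 1 ℤ.+ - a ℤ.* p
    lemma₂ = solve-∀

  record InverseModP (x y : ℕ) : Set where
    field
      positive : 1 ≤ y
      <p       : y < p
      inverse  : + x ℤ.* + y ≡ + 1 [mod p ]

  inverse-exists : ∀ {x} → 1 ≤ x → x < p → ∃ (InverseModP x)
  inverse-exists {x@(suc _)} _ x<p with bézout⇒inverse (coprime-Bézout (prime⇒coprime p-prime x<p))
  ... | y , xy≡1 = y %ℕ p , record { positive = positive ; <p = n%ℕd<d y p ; inverse = x[y%p]≡1 }
    where
    y≡y%p : y ≡ + (y %ℕ p) [mod p ]
    y≡y%p = mod-witness (y /ℕ p) (a≡a%ℕn+[a/ℕn]*n y p)
    x[y%p]≡1 : + x ℤ.* + (y %ℕ p) ≡ + 1 [mod p ]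
    x[y%p]≡1 = mod-trans (*-congˡ-mod (+ x) (mod-sym y≡y%p)) xy≡1
    positive : 1 ≤ y %ℕ p
    positive with y %ℕ p | x[y%p]≡1
    ... | suc _ | _      = s≤s z≤n
    ... | zero  | x0≡1 = ⊥-elim (0≢1-mod-p (subst (λ t → t ≡ + 1 [mod p ]) (ℤ.*-zeroʳ (+ x)) x0≡1))

  -- inv x is 0 outside [1, p).
  inv : ℕ → ℕ
  inv x with 1 ≤? x | x <? p
  ... | yes 1≤x | yes x<p = proj₁ (inverse-exists 1≤x x<p)
  ... | _       | _       = 0

  inv-inverse : ∀ {x} → 1 ≤ x → x < p → InverseModP x (inv x)
  inv-inverse {x} 1≤x x<p with 1 ≤? x | x <? p
  ... | yes 1≤x′ | yes x<p′ = proj₂ (inverse-exists 1≤x′ x<p′)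
  ... | no 1≰x   | _        = ⊥-elim (1≰x 1≤x)
  ... | yes _    | no x≮p   = ⊥-elim (x≮p x<p)

  inv-unique : ∀ {x y} → 1 ≤ x → x < p → y < p → + x ℤ.* + y ≡ + 1 [mod p ] → y ≡ inv x
  inv-unique {x} {y} 1≤x x<p y<p xy≡1 = mod-p-injective y<p (InverseModP.<p x⁻¹) (begin
    + y                          ≡⟨ ℤ.*-identityˡ (+ y) ⟨
    + 1 ℤ.* + y                  ≈⟨ *-congʳ-mod (+ y) (InverseModP.inverse x⁻¹) ⟨
    + x ℤ.* + inv x ℤ.* + y      ≡⟨ lemma (+ x) (+ inv x) (+ y) ⟩
    + inv x ℤ.* (+ x ℤ.* + y)    ≈⟨ *-congˡ-mod (+ inv x) xy≡1 ⟩
    + inv x ℤ.* + 1              ≡⟨ ℤ.*-identityʳ (+ inv x) ⟩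
    + inv x                      ∎)
    where
    open SetoidReasoning mod-setoid
    x⁻¹ = inv-inverse 1≤x x<p
    lemma : ∀ a b c → a ℤ.* b ℤ.* c ≡ b ℤ.* (a ℤ.* c)
    lemma = solve-∀

  inv-involutive : ∀ {x} → 1 ≤ x → x < p → inv (inv x) ≡ x
  inv-involutive {x} 1≤x x<p = sym (inv-unique positive <p x<p (mod-trans (mod-reflexive (ℤ.*-comm (+ inv x) (+ x))) inverse))
    where open InverseModP (inv-inverse 1≤x x<p)

  inv[p-1]≡p-1 : inv (suc p′) ≡ suc p′
  inv[p-1]≡p-1 = sym (inv-unique (s≤s z≤n) ℕ.≤-refl ℕ.≤-refl (mod-witness (+ p′) (begin
    + suc p′ ℤ.* + suc p′           ≡⟨ ℤ.pos-* (suc p′) (suc p′) ⟨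
    + (suc p′ * suc p′)              ≡⟨ cong +_ (lemma p′) ⟩
    + (1 + p′ * p)                   ≡⟨ cong (λ t → + 1 ℤ.+ t) (ℤ.pos-* p′ p) ⟩
    + 1 ℤ.+ + p′ ℤ.* + p            ∎)))
    where
    open ≡-Reasoning
    lemma : ∀ q → suc q * suc q ≡ 1 + q * suc (suc q)
    lemma = ℕ-solve-∀

  inv-fixed : ∀ {x} → 1 ≤ x → x < p → inv x ≡ x → x ≡ 1 ⊎ x ≡ suc p′
  inv-fixed {x@(suc x′)} 1≤x x<p inv-x≡x with euclidsLemma x′ (suc x) p-prime p∣x′[x+1]
    where
    x²≡1 : + x ℤ.* + x ≡ + 1 [mod p ]
    x²≡1 = subst (λ y → + x ℤ.* + y ≡ + 1 [mod p ]) inv-x≡x (InverseModP.inverse (inv-inverse 1≤x x<p))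
    x²≡1+x′[x+1] : x * x ≡ 1 + x′ * suc x
    x²≡1+x′[x+1] = lemma x′
      where lemma : ∀ q → suc q * suc q ≡ 1 + q * suc (suc q)
            lemma = ℕ-solve-∀
    p∣x′[x+1] : p ∣ x′ * suc x
    p∣x′[x+1] = subst (p ∣_) (cong (_∸ 1) x²≡1+x′[x+1])
      (mod⇒∣∸ (ℕ.*-mono-≤ 1≤x 1≤x) (mod-sym (subst (λ t → t ≡ + 1 [mod p ]) (sym (ℤ.pos-* x x)) x²≡1)))
  ... | inj₁ p∣x′   = inj₁ (cong suc (∣-<⇒≡0 p∣x′ (ℕ.<-trans (ℕ.n<1+n x′) x<p)))
  ... | inj₂ p∣x+1 = inj₂ (ℕ.suc-injective (ℕ.≤-antisym x<p (∣⇒≤ p∣x+1)))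

  paired : ℕ → ℕ → Bool
  paired m i = does (i ≤? m) ∧ does (inv i ≤? m)

  paired-true : ∀ {m i} → i ≤ m → inv i ≤ m → paired m i ≡ true
  paired-true {m} {i} i≤m inv-i≤m rewrite dec-true (i ≤? m) i≤m | dec-true (inv i ≤? m) inv-i≤m = refl

  paired-false : ∀ {m i} → m < i ⊎ m < inv i → paired m i ≡ false
  paired-false {m} {i} (inj₁ m<i) rewrite dec-false (i ≤? m) (ℕ.<⇒≱ m<i) = refl
  paired-false {m} {i} (inj₂ m<inv-i) rewrite dec-false (inv i ≤? m) (ℕ.<⇒≱ m<inv-i) = ∧-zeroʳ (does (i ≤? m))

  ≤?-suc : ∀ {i m} → i ≢ suc m → does (i ≤? suc m) ≡ does (i ≤? m)
  ≤?-suc {i} {m} i≢1+m with i ≤? m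
  ... | yes i≤m = trans (dec-true (i ≤? suc m) (ℕ.m≤n⇒m≤1+n i≤m)) (sym (dec-true (i ≤? m) i≤m))
  ... | no  i≰m =
    trans (dec-false (i ≤? suc m) (λ i≤1+m → i≰m (ℕ.≤-pred (ℕ.≤∧≢⇒< i≤1+m i≢1+m)))) (sym (dec-false (i ≤? m) i≰m))

  paired-suc : ∀ {m i} → i ≢ suc m → inv i ≢ suc m → paired (suc m) i ≡ paired m i
  paired-suc i≢1+m inv-i≢1+m = cong₂ _∧_ (≤?-suc i≢1+m) (≤?-suc inv-i≢1+m)

  ≤p′⇒<p : ∀ {i} → i ≤ p′ → i < p
  ≤p′⇒<p i≤p′ = s≤s (ℕ.m≤n⇒m≤1+n i≤p′)

  module _ {m : ℕ} (y≤p′ : suc m ≤ p′) where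
    private
      y = suc m
      y<p : y < p
      y<p = ≤p′⇒<p y≤p′

    ≡inv-y : ∀ {i} → 1 ≤ i → i ≤ p′ → inv i ≡ y → i ≡ inv y
    ≡inv-y 1≤i i≤p′ inv-i≡y = trans (sym (inv-involutive 1≤i (≤p′⇒<p i≤p′))) (cong inv inv-i≡y)

    paired-suc-away : ∀ {i} → 1 ≤ i → i ≤ p′ → i ≢ y → i ≢ inv y → paired y i ≡ paired m i
    paired-suc-away 1≤i i≤p′ i≢y i≢inv-y = paired-suc i≢y (i≢inv-y ∘ ≡inv-y 1≤i i≤p′)

    product-step-fixed : inv y ≡ y → productWhere (paired y) p′ ≡ productWhere (paired m) p′
    product-step-fixed inv-y≡y = begin
      productWhere (paired y) p′      ≡⟨ productWhere-insert p′ (s≤s z≤n) y≤p′ (paired-false {m} (inj₁ ℕ.≤-refl))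
                                           (paired-true {y} ℕ.≤-refl (ℕ.≤-reflexive inv-y≡y))
                                           (λ 1≤i i≤p′ i≢y → sym (paired-suc-away 1≤i i≤p′ i≢y (subst (_ ≢_) (sym inv-y≡y) i≢y))) ⟩
      y * productWhere (paired m) p′  ≡⟨ cong (_* productWhere (paired m) p′) y≡1 ⟩
      1 * productWhere (paired m) p′  ≡⟨ ℕ.*-identityˡ _ ⟩
      productWhere (paired m) p′      ∎
      where
      open ≡-Reasoning
      y≡1 : y ≡ 1
      y≡1 with inv-fixed (s≤s z≤n) y<p inv-y≡y
      ... | inj₁ y≡1     = y≡1
      ... | inj₂ refl = ⊥-elim (ℕ.<-irrefl refl y≤p′)

    product-step-skip : y < inv y → productWhere (paired y) p′ ≡ productWhere (paired m) p′
    product-step-skip y<inv-y = productWhere-cong p′ same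
      where
      same : ∀ {i} → 1 ≤ i → i ≤ p′ → paired y i ≡ paired m i
      same {i} 1≤i i≤p′ with i ℕ.≟ y | i ℕ.≟ inv y
      ... | yes refl | _        = trans (paired-false {y} {y} (inj₂ y<inv-y)) (sym (paired-false {m} {y} (inj₁ ℕ.≤-refl)))
      ... | no _     | yes refl =
        trans (paired-false {y} {inv y} (inj₁ y<inv-y)) (sym (paired-false {m} {inv y} (inj₁ (ℕ.<-trans ℕ.≤-refl y<inv-y))))
      ... | no i≢y   | no i≢inv-y = paired-suc-away 1≤i i≤p′ i≢y i≢inv-y

    product-step-pair : inv y < y → productWhere (paired y) p′ ≡ y * (inv y * productWhere (paired m) p′)
    product-step-pair z<y = begin
      productWhere (paired y) p′
        ≡⟨ productWhere-insert p′ (s≤s z≤n) y≤p′ with-z-y (paired-true {y} ℕ.≤-refl (ℕ.<⇒≤ z<y)) with-z≗paired-y ⟩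
      y * productWhere with-z p′
        ≡⟨ cong (y *_) (productWhere-insert p′ 1≤z z≤p′ (paired-false {m} {z} (inj₂ m<inv-z)) with-z-z paired-m≗with-z) ⟩
      y * (z * productWhere (paired m) p′) ∎
      where
      open ≡-Reasoning
      z = inv y
      open InverseModP (inv-inverse (s≤s z≤n) y<p) using () renaming (positive to 1≤z)
      z≤p′ : z ≤ p′
      z≤p′ = ℕ.≤-trans (ℕ.≤-pred z<y) (ℕ.≤-trans (ℕ.n≤1+n m) y≤p′)
      m<inv-z : m < inv z
      m<inv-z = subst (m <_) (sym (inv-involutive (s≤s z≤n) y<p)) ℕ.≤-refl

      with-z : ℕ → Bool
      with-z i = does (i ℕ.≟ z) ∨ paired m i

      with-z-z : with-z z ≡ true
      with-z-z rewrite dec-true (z ℕ.≟ z) refl = refl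

      with-z-y : with-z y ≡ false
      with-z-y rewrite dec-false (y ℕ.≟ z) (ℕ.>⇒≢ z<y) = paired-false {m} {y} (inj₁ ℕ.≤-refl)

      paired-m≗with-z : ∀ {i} → 1 ≤ i → i ≤ p′ → i ≢ z → paired m i ≡ with-z i
      paired-m≗with-z {i} _ _ i≢z rewrite dec-false (i ℕ.≟ z) i≢z = refl

      with-z≗paired-y : ∀ {i} → 1 ≤ i → i ≤ p′ → i ≢ y → with-z i ≡ paired y i
      with-z≗paired-y {i} 1≤i i≤p′ i≢y with i ℕ.≟ z
      ... | yes refl = trans with-z-z (sym (paired-true {y} {z} (ℕ.<⇒≤ z<y) (ℕ.≤-reflexive (inv-involutive (s≤s z≤n) y<p))))
      ... | no i≢z   = trans (sym (paired-m≗with-z 1≤i i≤p′ i≢z)) (sym (paired-suc-away 1≤i i≤p′ i≢y i≢z))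

  -- As m grows, the indices i ≤ p - 2 with i, inv i ≤ m gain nothing, the self-inverse 1,
  -- or a pair {m, inv m} with product ≡ 1.
  paired-product : ∀ m → m ≤ p′ → + productWhere (paired m) p′ ≡ + 1 [mod p ]
  paired-product zero _ = mod-reflexive (cong +_ (trans (productWhere-cong p′ none-paired) (productWhere-false p′)))
    where none-paired : ∀ {i} → 1 ≤ i → i ≤ p′ → paired 0 i ≡ false
          none-paired {i} 1≤i _ = paired-false {0} {i} (inj₁ 1≤i)
  paired-product (suc m) y≤p′ with ℕ.<-cmp (inv (suc m)) (suc m)
  ... | tri< z<y _ _ = begin
    + productWhere (paired y) p′                      ≡⟨ cong +_ (product-step-pair y≤p′ z<y) ⟩
    + (y * (inv y * productWhere (paired m) p′))      ≡⟨ lemma y (inv y) (productWhere (paired m) p′) ⟩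
    + y ℤ.* + inv y ℤ.* + productWhere (paired m) p′  ≈⟨ *-cong-mod (InverseModP.inverse (inv-inverse (s≤s z≤n) (≤p′⇒<p y≤p′))) ih ⟩
    + 1 ℤ.* + 1                                       ≡⟨⟩
    + 1                                               ∎
    where
    open SetoidReasoning mod-setoid
    y = suc m
    ih = paired-product m (ℕ.≤-trans (ℕ.n≤1+n m) y≤p′)
    lemma : ∀ a b c → + (a * (b * c)) ≡ + a ℤ.* + b ℤ.* + c
    lemma a b c = trans (cong +_ (sym (ℕ.*-assoc a b c))) (trans (ℤ.pos-* (a * b) c) (cong (ℤ._* + c) (ℤ.pos-* a b)))
  ... | tri≈ _ z≡y _ = mod-trans (mod-reflexive (cong +_ (product-step-fixed y≤p′ z≡y)))
                                 (paired-product m (ℕ.≤-trans (ℕ.n≤1+n m) y≤p′))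
  ... | tri> _ _ y<z = mod-trans (mod-reflexive (cong +_ (product-step-skip y≤p′ y<z)))
                                 (paired-product m (ℕ.≤-trans (ℕ.n≤1+n m) y≤p′))

  inv≤p′ : ∀ {i} → 1 ≤ i → i ≤ p′ → inv i ≤ p′
  inv≤p′ {i} 1≤i i≤p′ = ℕ.≤-pred (ℕ.≤∧≢⇒< (ℕ.≤-pred (InverseModP.<p i⁻¹)) inv-i≢p-1)
    where
    i⁻¹ = inv-inverse 1≤i (≤p′⇒<p i≤p′)
    inv-i≢p-1 : inv i ≢ suc p′
    inv-i≢p-1 inv-i≡p-1 = ℕ.<-irrefl refl (subst (_≤ p′) i≡p-1 i≤p′)
      where i≡p-1 : i ≡ suc p′
            i≡p-1 = trans (sym (inv-involutive 1≤i (≤p′⇒<p i≤p′))) (trans (cong inv inv-i≡p-1) inv[p-1]≡p-1)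

  wilson : + (suc p′ !) ≡ - + 1 [mod p ]
  wilson = begin
    + (suc p′ !)                                 ≡⟨ ℤ.pos-* (suc p′) (p′ !) ⟩
    + suc p′ ℤ.* + (p′ !)                        ≡⟨ cong (λ n → + suc p′ ℤ.* + n) all-paired ⟨
    + suc p′ ℤ.* + productWhere (paired p′) p′   ≈⟨ *-cong-mod p-1≡-1 (paired-product p′ ℕ.≤-refl) ⟩
    - + 1 ℤ.* + 1                                ≡⟨⟩
    - + 1                                        ∎
    where
    open SetoidReasoning mod-setoid
    all-paired : productWhere (paired p′) p′ ≡ p′ !
    all-paired = trans (productWhere-cong p′ (λ 1≤i i≤p′ → paired-true i≤p′ (inv≤p′ 1≤i i≤p′))) (productWhere-true p′)
    p-1≡-1 : + suc p′ ≡ - + 1 [mod p ]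
    p-1≡-1 = mod-witness (+ 1) (lemma (+ suc p′))
      where lemma : ∀ n → n ≡ - + 1 ℤ.+ + 1 ℤ.* (+ 1 ℤ.+ n)
            lemma = solve-∀

  -- The p-free factorial modulo powers of p

  coprimeProductFrom : ℕ → ℕ → ℕ
  coprimeProductFrom s zero    = 1
  coprimeProductFrom s (suc t) = keepCoprime (s + suc t) * coprimeProductFrom s t

  coprimeFactorial-+ : ∀ s t → coprimeFactorial (s + t) ≡ coprimeFactorial s * coprimeProductFrom s t
  coprimeFactorial-+ s zero    = trans (cong coprimeFactorial (ℕ.+-identityʳ s)) (sym (ℕ.*-identityʳ _))
  coprimeFactorial-+ s (suc t) = begin
    coprimeFactorial (s + suc t)
      ≡⟨ cong coprimeFactorial (ℕ.+-suc s t) ⟩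
    keepCoprime (suc (s + t)) * coprimeFactorial (s + t)
      ≡⟨ cong₂ (λ n c → keepCoprime n * c) (sym (ℕ.+-suc s t)) (coprimeFactorial-+ s t) ⟩
    keepCoprime (s + suc t) * (coprimeFactorial s * coprimeProductFrom s t)
      ≡⟨ x∙yz≈y∙xz (keepCoprime (s + suc t)) (coprimeFactorial s) _ ⟩
    coprimeFactorial s * coprimeProductFrom s (suc t) ∎
    where open ≡-Reasoning

  keepCoprime-periodic : ∀ {n} s t → p ∣ n → n ∣ s → + keepCoprime (s + t) ≡ + keepCoprime t [mod n ]
  keepCoprime-periodic {n} s t p∣n n∣s with p ∣? t
  ... | yes p∣t = mod-reflexive (cong +_ (trans (keepCoprime-∣ (∣m∣n⇒∣m+n p∣s p∣t)) (sym (keepCoprime-∣ p∣t))))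
    where p∣s = ∣-trans p∣n n∣s
  ... | no  p∤t = begin
    + keepCoprime (s + t)  ≡⟨ cong +_ (keepCoprime-∤ p∤s+t) ⟩
    + (s + t)              ≈⟨ multiple+-mod t n∣s ⟩
    + t                    ≡⟨ cong +_ (keepCoprime-∤ p∤t) ⟨
    + keepCoprime t        ∎
    where
    open SetoidReasoning mod-setoid
    p∤s+t : p ∤ s + t
    p∤s+t p∣s+t = p∤t (∣m+n∣m⇒∣n p∣s+t (∣-trans p∣n n∣s))

  coprimeProductFrom-periodic : ∀ {n s} t → p ∣ n → n ∣ s → + coprimeProductFrom s t ≡ + coprimeFactorial t [mod n ]
  coprimeProductFrom-periodic zero    _   _   = mod-refl
  coprimeProductFrom-periodic {s = s} (suc t) p∣n n∣s = begin
    + (keepCoprime (s + suc t) * coprimeProductFrom s t)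
      ≡⟨ ℤ.pos-* (keepCoprime (s + suc t)) (coprimeProductFrom s t) ⟩
    + keepCoprime (s + suc t) ℤ.* + coprimeProductFrom s t
      ≈⟨ *-cong-mod (keepCoprime-periodic s (suc t) p∣n n∣s) (coprimeProductFrom-periodic t p∣n n∣s) ⟩
    + keepCoprime (suc t) ℤ.* + coprimeFactorial t
      ≡⟨ ℤ.pos-* (keepCoprime (suc t)) (coprimeFactorial t) ⟨
    + coprimeFactorial (suc t) ∎
    where open SetoidReasoning mod-setoid

  coprimeFactorial-multiple : ∀ {n} M → p ∣ n → + coprimeFactorial (M * n) ≡ (+ coprimeFactorial n) ℤ.^ M [mod n ]
  coprimeFactorial-multiple zero    _   = mod-refl
  coprimeFactorial-multiple {n} (suc M) p∣n = begin
    + coprimeFactorial (n + M * n)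
      ≡⟨ cong (λ k → + coprimeFactorial k) (ℕ.+-comm n (M * n)) ⟩
    + coprimeFactorial (M * n + n)
      ≡⟨ cong +_ (coprimeFactorial-+ (M * n) n) ⟩
    + (coprimeFactorial (M * n) * coprimeProductFrom (M * n) n)
      ≡⟨ ℤ.pos-* (coprimeFactorial (M * n)) (coprimeProductFrom (M * n) n) ⟩
    + coprimeFactorial (M * n) ℤ.* + coprimeProductFrom (M * n) n
      ≈⟨ *-cong-mod (coprimeFactorial-multiple M p∣n) (coprimeProductFrom-periodic n p∣n (n∣m*n M)) ⟩
    (+ coprimeFactorial n) ℤ.^ M ℤ.* + coprimeFactorial n
      ≡⟨ ℤ.*-comm ((+ coprimeFactorial n) ℤ.^ M) (+ coprimeFactorial n) ⟩
    (+ coprimeFactorial n) ℤ.^ suc M ∎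
    where open SetoidReasoning mod-setoid

  coprimeFactorial-p≡[p-1]! : coprimeFactorial p ≡ suc p′ !
  coprimeFactorial-p≡[p-1]! = trans (cong (_* coprimeFactorial (suc p′)) (keepCoprime-∣ (∣-refl {p})))
                                     (trans (ℕ.*-identityˡ _) (below-p (suc p′) ℕ.≤-refl))
    where
    below-p : ∀ n → n ≤ suc p′ → coprimeFactorial n ≡ n !
    below-p zero    _   = refl
    below-p (suc n) n<p = cong₂ _*_ (keepCoprime-∤ p∤1+n) (below-p n (ℕ.m≤n⇒m≤1+n (ℕ.≤-pred n<p)))
      where p∤1+n = subst (p ∤_) (cong (_+ suc n) (ℕ.*-zeroʳ p)) (p∤p*n+suc 0 (ℕ.≤-pred n<p))

  coprimeFactorial-p^suc : ∀ j → + coprimeFactorial (p ^ suc j) ≡ negOnePow p [mod p ^ j ]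
  coprimeFactorial-p^suc zero = mod-one _ _
  coprimeFactorial-p^suc (suc zero) = mod-weaken (∣-reflexive (ℕ.*-identityʳ p)) (begin
    + coprimeFactorial (p ^ 2)
      ≈⟨ mod-weaken (∣-reflexive (sym (ℕ.*-identityʳ p))) (coprimeFactorial-multiple p (∣-reflexive (sym (ℕ.*-identityʳ p)))) ⟩
    (+ coprimeFactorial (p ^ 1)) ℤ.^ p
      ≡⟨ cong (λ n → (+ coprimeFactorial n) ℤ.^ p) (ℕ.*-identityʳ p) ⟩
    (+ coprimeFactorial p) ℤ.^ p
      ≈⟨ ^-cong-mod p (subst (λ n → + n ≡ - + 1 [mod p ]) (sym coprimeFactorial-p≡[p-1]!) wilson) ⟩
    negOnePow 1 ℤ.^ p
      ≡⟨ negOnePow-^ 1 p ⟩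
    negOnePow (1 * p)
      ≡⟨ cong negOnePow (ℕ.*-identityˡ p) ⟩
    negOnePow p ∎)
    where open SetoidReasoning mod-setoid
  coprimeFactorial-p^suc (suc (suc j)) = begin
    + coprimeFactorial (p ^ suc (suc (suc j)))     ≈⟨ coprimeFactorial-multiple p (m∣m*n (p ^ suc j)) ⟩
    (+ coprimeFactorial (p ^ suc (suc j))) ℤ.^ p   ≈⟨ ^-lift-mod (suc p′) (p ^ j) (coprimeFactorial-p^suc (suc j)) ⟩
    negOnePow p ℤ.^ p                              ≡⟨ negOnePow-^ p p ⟩
    negOnePow (p * p)                              ≡⟨ negOnePow-*-self p ⟩
    negOnePow p                                    ∎
    where open SetoidReasoning mod-setoid

  coprimeFactorial-sign : ∀ j α → + coprimeFactorial (α * p ^ suc j) ≡ negOnePow (p * α) [mod p ^ j ]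
  coprimeFactorial-sign j α = begin
    + coprimeFactorial (α * p ^ suc j)   ≈⟨ mod-weaken (n∣m*n p) (coprimeFactorial-multiple α (m∣m*n (p ^ j))) ⟩
    (+ coprimeFactorial (p ^ suc j)) ℤ.^ α ≈⟨ ^-cong-mod α (coprimeFactorial-p^suc j) ⟩
    negOnePow p ℤ.^ α                    ≡⟨ negOnePow-^ p α ⟩
    negOnePow (p * α)                    ∎
    where open SetoidReasoning mod-setoid

  unitFactorial-suc-mod : ∀ α e → + unitFactorial α (suc e) ≡ + unitFactorial α e ℤ.* negOnePow (p * α) [mod p ^ e ]
  unitFactorial-suc-mod α e = begin
    + unitFactorial α (suc e)                                      ≡⟨ cong +_ (unitFactorial-suc α e) ⟩
    + (unitFactorial α e * coprimeFactorial (α * p ^ suc e))       ≡⟨ ℤ.pos-* (unitFactorial α e) _ ⟩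
    + unitFactorial α e ℤ.* + coprimeFactorial (α * p ^ suc e)     ≈⟨ *-congˡ-mod (+ unitFactorial α e) (coprimeFactorial-sign e α) ⟩
    + unitFactorial α e ℤ.* negOnePow (p * α)                      ∎
    where open SetoidReasoning mod-setoid

  unitFactorial-+ : ∀ α e t → + unitFactorial α (e + t) ≡ + unitFactorial α e ℤ.* negOnePow (p * α * t) [mod p ^ e ]
  unitFactorial-+ α e zero = mod-reflexive (begin
    + unitFactorial α (e + 0)                    ≡⟨ cong (λ k → + unitFactorial α k) (ℕ.+-identityʳ e) ⟩
    + unitFactorial α e                          ≡⟨ ℤ.*-identityʳ _ ⟨
    + unitFactorial α e ℤ.* + 1                  ≡⟨ cong (λ k → + unitFactorial α e ℤ.* negOnePow k) (ℕ.*-zeroʳ (p * α)) ⟨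
    + unitFactorial α e ℤ.* negOnePow (p * α * 0) ∎)
    where open ≡-Reasoning
  unitFactorial-+ α e (suc t) = begin
    + unitFactorial α (e + suc t)
      ≡⟨ cong (λ k → + unitFactorial α k) (ℕ.+-suc e t) ⟩
    + unitFactorial α (suc (e + t))
      ≈⟨ mod-weaken (^∣^+ p e t) (unitFactorial-suc-mod α (e + t)) ⟩
    + unitFactorial α (e + t) ℤ.* negOnePow (p * α)
      ≈⟨ *-congʳ-mod (negOnePow (p * α)) (unitFactorial-+ α e t) ⟩
    + unitFactorial α e ℤ.* negOnePow (p * α * t) ℤ.* negOnePow (p * α)
      ≡⟨ ℤ.*-assoc (+ unitFactorial α e) _ _ ⟩
    + unitFactorial α e ℤ.* (negOnePow (p * α * t) ℤ.* negOnePow (p * α))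
      ≡⟨ cong (+ unitFactorial α e ℤ.*_) (negOnePow-+ (p * α * t) (p * α)) ⟨
    + unitFactorial α e ℤ.* negOnePow (p * α * t + p * α)
      ≡⟨ cong (λ k → + unitFactorial α e ℤ.* negOnePow k) (trans (ℕ.+-comm _ (p * α)) (sym (ℕ.*-suc (p * α) t))) ⟩
    + unitFactorial α e ℤ.* negOnePow (p * α * suc t) ∎
    where open SetoidReasoning mod-setoid

  unitFactorial-unitPart : ∀ {α κ α′} → p ^ κ * α′ ≡ α → ∀ e →
    + unitFactorial α e ≡ + unitFactorial α′ e ℤ.* negOnePow (p * α′ * κ) [mod p ^ e ]
  unitFactorial-unitPart {α} {κ} {α′} refl e = begin
    + unitFactorial α e                         ≡⟨ cong (λ n → + u p (n !)) α*p^e≡α′*p^[e+κ] ⟩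
    + unitFactorial α′ (e + κ)                  ≈⟨ unitFactorial-+ α′ e κ ⟩
    + unitFactorial α′ e ℤ.* negOnePow (p * α′ * κ) ∎
    where
    open SetoidReasoning mod-setoid
    α*p^e≡α′*p^[e+κ] : p ^ κ * α′ * p ^ e ≡ α′ * p ^ (e + κ)
    α*p^e≡α′*p^[e+κ] = trans (lemma (p ^ κ) α′ (p ^ e)) (cong (α′ *_) (sym (ℕ.^-distribˡ-+-* p e κ)))
      where lemma : ∀ a b c → a * b * c ≡ b * (c * a)
            lemma = ℕ-solve-∀

  ∣-cancel-coprime : ∀ n {A w} → p ∤ w → p ^ n ∣ A * w → p ^ n ∣ A
  ∣-cancel-coprime zero    {A} _ _ = divides A (sym (ℕ.*-identityʳ A))
  ∣-cancel-coprime (suc n) {A} {w} p∤w p^[1+n]∣Aw with euclidsLemma A w p-prime (∣-trans (m∣m*n (p ^ n)) p^[1+n]∣Aw)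
  ... | inj₂ p∣w = ⊥-elim (p∤w p∣w)
  ... | inj₁ (divides A′ refl) = subst (p * p ^ n ∣_) (ℕ.*-comm p A′) (*-monoʳ-∣ p p^n∣A′)
    where
    p^n∣A′ : p ^ n ∣ A′
    p^n∣A′ = ∣-cancel-coprime n p∤w (*-cancelˡ-∣ p (subst (p * p ^ n ∣_) (lemma A′ p w) p^[1+n]∣Aw))
      where lemma : ∀ a b c → a * b * c ≡ b * (a * c)
            lemma = ℕ-solve-∀

  *-cancelʳ-coprime-mod : ∀ n {x y w} → p ∤ w → x ℤ.* + w ≡ y ℤ.* + w [mod p ^ n ] → x ≡ y [mod p ^ n ]
  *-cancelʳ-coprime-mod n {x} {y} {w} p∤w xw≡yw = ∣⇒mod (∣-cancel-coprime n p∤w (subst (p ^ n ∣_) ∣xw-yw∣≡∣x-y∣w (mod⇒∣ xw≡yw)))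
    where
    ∣xw-yw∣≡∣x-y∣w : ℤ.∣ x ℤ.* + w - y ℤ.* + w ∣ ≡ ℤ.∣ x - y ∣ * w
    ∣xw-yw∣≡∣x-y∣w = trans (cong ℤ.∣_∣ (lemma x y (+ w))) (ℤ.abs-* (x - y) (+ w))
      where lemma : ∀ x y w → x ℤ.* w - y ℤ.* w ≡ (x - y) ℤ.* w
            lemma = solve-∀

  negOnePow-unitPart : ∀ {x κ x′} → p ^ κ * x′ ≡ x → ∀ y → negOnePow (p * x′ * y) ≡ negOnePow (p * x * y)
  negOnePow-unitPart {κ = κ} {x′} refl y = begin
    negOnePow (p * x′ * y)                ≡⟨ cong negOnePow (ℕ.*-assoc p x′ y) ⟩
    negOnePow (p * (x′ * y))              ≡⟨ negOnePow-*-^ p κ (x′ * y) ⟨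
    negOnePow (p * (p ^ κ * (x′ * y)))    ≡⟨ cong (λ n → negOnePow (p * n)) (ℕ.*-assoc (p ^ κ) x′ y) ⟨
    negOnePow (p * (p ^ κ * x′ * y))      ≡⟨ cong negOnePow (ℕ.*-assoc p (p ^ κ * x′) y) ⟨
    negOnePow (p * (p ^ κ * x′) * y)      ∎
    where open ≡-Reasoning

  -- zSeq with u(x) replaced by x; the sign (-1)^(p x ν(x)) compensates for the extra
  -- factor p^ν(x).
  zSeq′ : ℕ → ℕ → ℤ
  zSeq′ x e = negOnePow (p * x * e) ℤ.* negOnePow (p * x * ν p x) ℤ.* + unitFactorial x e

  zSeq≡zSeq′ : ∀ {x} → 1 ≤ x → ∀ e → zSeq p x e ≡ zSeq′ x e [mod p ^ e ]
  zSeq≡zSeq′ {x} 1≤x e = begin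
    negOnePow (p * x′ * e) ℤ.* + unitFactorial x′ e
      ≡⟨ *-negOnePow-involutive _ (p * x′ * κ) ⟨
    negOnePow (p * x′ * e) ℤ.* + unitFactorial x′ e ℤ.* σ′ ℤ.* σ′
      ≡⟨ lemma (negOnePow (p * x′ * e)) (+ unitFactorial x′ e) σ′ ⟩
    negOnePow (p * x′ * e) ℤ.* σ′ ℤ.* (+ unitFactorial x′ e ℤ.* σ′)
      ≈⟨ *-congˡ-mod (negOnePow (p * x′ * e) ℤ.* σ′) (unitFactorial-unitPart {x} {κ} {x′} p^κx′≡x e) ⟨
    negOnePow (p * x′ * e) ℤ.* σ′ ℤ.* + unitFactorial x e
      ≡⟨ cong₂ (λ s t → s ℤ.* t ℤ.* + unitFactorial x e) (negOnePow-unitPart {x} {κ} {x′} p^κx′≡x e)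
                                                        (negOnePow-unitPart {x} {κ} {x′} p^κx′≡x κ) ⟩
    zSeq′ x e ∎
    where
    open SetoidReasoning mod-setoid
    x′ = u p x
    κ = ν p x
    σ′ = negOnePow (p * x′ * κ)
    p^κx′≡x : p ^ κ * x′ ≡ x
    p^κx′≡x = Decomposition.product (ν-u-decomposition x 1≤x)
    lemma : ∀ s g t → s ℤ.* g ℤ.* t ℤ.* t ≡ s ℤ.* t ℤ.* (g ℤ.* t)
    lemma = solve-∀

  -- Binomial coefficients

  nCk*k!*[n∸k]!≡n! : ∀ {n k} → k ≤ n → (n C k) * (k ! * (n ∸ k) !) ≡ n !
  nCk*k!*[n∸k]!≡n! {n} {k} k≤n = begin
    (n C k) * (k ! * (n ∸ k) !)               ≡⟨ ℕ.*-comm (n C k) _ ⟩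
    k ! * (n ∸ k) ! * (n C k)                 ≡⟨ cong (k ! * (n ∸ k) ! *_) (nCk≡n!/k![n-k]! k≤n) ⟩
    k ! * (n ∸ k) ! * (n ! / (k ! * (n ∸ k) !)) ≡⟨ m*[n/m]≡n (k![n∸k]!∣n! k≤n) ⟩
    n !                                       ∎
    where
    open ≡-Reasoning
    instance _ = k !* (n ∸ k) !≢0

  binomialSeq : ℕ → ℕ → ℕ → ℕ
  binomialSeq a b e = (a * p ^ e) C (b * p ^ e)

  module _ {a b : ℕ} (1≤b : 1 ≤ b) (b<a : b < a) where
    private
      d = a ∸ b
      B = binomialSeq a b
      b≤a = ℕ.<⇒≤ b<a

    binomialSeq-factorials : ∀ e → B e * ((b * p ^ e) ! * (d * p ^ e) !) ≡ (a * p ^ e) !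
    binomialSeq-factorials e = trans (cong (λ n → B e * ((b * p ^ e) ! * n !)) (ℕ.*-distribʳ-∸ (p ^ e) a b))
                                     (nCk*k!*[n∸k]!≡n! (ℕ.*-monoˡ-≤ (p ^ e) b≤a))

    binomialSeq-positive : ∀ e → 1 ≤ B e
    binomialSeq-positive e = ℕ.n≢0⇒n>0 λ B≡0 →
      ℕ.<-irrefl refl (subst (1 ≤_) (trans (sym (binomialSeq-factorials e)) (cong (_* ((b * p ^ e) ! * (d * p ^ e) !)) B≡0))
                                   (ℕ.1≤n! (a * p ^ e)))

    factorial-decomposition-binomial : ∀ e → Decomposition ((a * p ^ e) !)
      (ν p (B e) + (ν p ((b * p ^ e) !) + ν p ((d * p ^ e) !))) (u p (B e) * (unitFactorial b e * unitFactorial d e))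
    factorial-decomposition-binomial e =
      subst (λ n → Decomposition n (ν p (B e) + (ν p ((b * p ^ e) !) + ν p ((d * p ^ e) !)))
                                   (u p (B e) * (unitFactorial b e * unitFactorial d e)))
            (binomialSeq-factorials e)
      (decomposition-* (ν-u-decomposition (B e) (binomialSeq-positive e))
        (decomposition-* (factorial-decomposition b e) (factorial-decomposition d e)))

    ν-binomialSeq : ∀ e → ν p (B e) ≡ ν p (a C b)
    ν-binomialSeq zero    = cong (ν p) (cong₂ _C_ (ℕ.*-identityʳ a) (ℕ.*-identityʳ b))
    ν-binomialSeq (suc e) = trans (ℕ.+-cancelʳ-≡ T (ν p (B (suc e))) (ν p (B e)) (begin
      ν p (B (suc e)) + T
        ≡⟨ cong (λ t → ν p (B (suc e)) + t) (cong₂ _+_ (ν-factorial-suc b e) (ν-factorial-suc d e)) ⟨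
      ν p (B (suc e)) + (ν p ((b * p ^ suc e) !) + ν p ((d * p ^ suc e) !))
        ≡⟨ ν-decomposition (suc e) ⟨
      ν p ((a * p ^ suc e) !)
        ≡⟨ ν-factorial-suc a e ⟩
      a * p ^ e + ν p ((a * p ^ e) !)
        ≡⟨ cong₂ _+_ a*p^e≡ (ν-decomposition e) ⟩
      (b * p ^ e + d * p ^ e) + (ν p (B e) + (νb + νd))
        ≡⟨ lemma (b * p ^ e) (d * p ^ e) (ν p (B e)) νb νd ⟩
      ν p (B e) + T ∎)) (ν-binomialSeq e)
      where
      open ≡-Reasoning
      νb = ν p ((b * p ^ e) !)
      νd = ν p ((d * p ^ e) !)
      T = (b * p ^ e + νb) + (d * p ^ e + νd)
      ν-decomposition : ∀ e → ν p ((a * p ^ e) !) ≡ ν p (B e) + (ν p ((b * p ^ e) !) + ν p ((d * p ^ e) !))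
      ν-decomposition e = proj₁ (decomposition⇒ν,u (factorial-decomposition-binomial e))
      a*p^e≡ : a * p ^ e ≡ b * p ^ e + d * p ^ e
      a*p^e≡ = trans (cong (_* p ^ e) (sym (ℕ.m+[n∸m]≡n b≤a))) (ℕ.*-distribʳ-+ (p ^ e) b d)
      lemma : ∀ x y v β δ → (x + y) + (v + (β + δ)) ≡ v + ((x + β) + (y + δ))
      lemma = ℕ-solve-∀

    unitFactorial-binomial : ∀ e → + unitFactorial a e ≡ + u p (B e) ℤ.* + (unitFactorial b e * unitFactorial d e)
    unitFactorial-binomial e =
      trans (cong +_ (proj₂ (decomposition⇒ν,u (factorial-decomposition-binomial e)))) (ℤ.pos-* (u p (B e)) _)

    negOnePow-split : ∀ m n → negOnePow (m * a * n) ≡ negOnePow (m * b * n) ℤ.* negOnePow (m * d * n)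
    negOnePow-split m n = trans (cong negOnePow (trans (cong (λ x → m * x * n) (sym (ℕ.m+[n∸m]≡n b≤a))) (lemma m b d n)))
                                (negOnePow-+ (m * b * n) (m * d * n))
      where lemma : ∀ m b d n → m * (b + d) * n ≡ m * b * n + m * d * n
            lemma = ℕ-solve-∀

    negOnePow-p*a : negOnePow (p * a) ≡ negOnePow (p * b) ℤ.* negOnePow (p * d)
    negOnePow-p*a = begin
      negOnePow (p * a)
        ≡⟨ cong negOnePow (ℕ.*-identityʳ (p * a)) ⟨
      negOnePow (p * a * 1)
        ≡⟨ negOnePow-split p 1 ⟩
      negOnePow (p * b * 1) ℤ.* negOnePow (p * d * 1)
        ≡⟨ cong₂ (λ x y → negOnePow x ℤ.* negOnePow y) (ℕ.*-identityʳ (p * b)) (ℕ.*-identityʳ (p * d)) ⟩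
      negOnePow (p * b) ℤ.* negOnePow (p * d) ∎
      where open ≡-Reasoning

    unitBinomial-coherent : ∀ e → + u p (B (suc e)) ≡ + u p (B e) [mod p ^ e ]
    unitBinomial-coherent e =
      *-cancelʳ-coprime-mod e (p∤* (p∤unit (factorial-decomposition b e)) (p∤unit (factorial-decomposition d e)))
      (*-cancelʳ-negOnePow-mod (p * a) (begin
        + u p (B (suc e)) ℤ.* + (Gb * Gd) ℤ.* negOnePow (p * a)
          ≡⟨ cong₂ (λ g s → + u p (B (suc e)) ℤ.* g ℤ.* s) (ℤ.pos-* Gb Gd) negOnePow-p*a ⟩
        + u p (B (suc e)) ℤ.* (+ Gb ℤ.* + Gd) ℤ.* (negOnePow (p * b) ℤ.* negOnePow (p * d))
          ≡⟨ lemma (+ u p (B (suc e))) (+ Gb) (+ Gd) (negOnePow (p * b)) (negOnePow (p * d)) ⟩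
        + u p (B (suc e)) ℤ.* ((+ Gb ℤ.* negOnePow (p * b)) ℤ.* (+ Gd ℤ.* negOnePow (p * d)))
          ≈⟨ *-congˡ-mod (+ u p (B (suc e))) (*-cong-mod (unitFactorial-suc-mod b e) (unitFactorial-suc-mod d e)) ⟨
        + u p (B (suc e)) ℤ.* (+ unitFactorial b (suc e) ℤ.* + unitFactorial d (suc e))
          ≡⟨ trans (cong (+ u p (B (suc e)) ℤ.*_) (sym (ℤ.pos-* (unitFactorial b (suc e)) (unitFactorial d (suc e)))))
                   (sym (unitFactorial-binomial (suc e))) ⟩
        + unitFactorial a (suc e)
          ≈⟨ unitFactorial-suc-mod a e ⟩
        + unitFactorial a e ℤ.* negOnePow (p * a)
          ≡⟨ cong (ℤ._* negOnePow (p * a)) (unitFactorial-binomial e) ⟩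
        + u p (B e) ℤ.* + (Gb * Gd) ℤ.* negOnePow (p * a)   ∎))
      where
      open SetoidReasoning mod-setoid
      Gb = unitFactorial b e
      Gd = unitFactorial d e
      lemma : ∀ u g h s t → u ℤ.* (g ℤ.* h) ℤ.* (s ℤ.* t) ≡ u ℤ.* ((g ℤ.* s) ℤ.* (h ℤ.* t))
      lemma = solve-∀

    binomialSeq-unitPart : ∀ e → + B e ≡ + (p ^ ν p (a C b)) ℤ.* + u p (B e)
    binomialSeq-unitPart e = begin
      + B e                              ≡⟨ cong +_ (Decomposition.product (ν-u-decomposition (B e) (binomialSeq-positive e))) ⟨
      + (p ^ ν p (B e) * u p (B e))      ≡⟨ cong (λ v → + (p ^ v * u p (B e))) (ν-binomialSeq e) ⟩
      + (p ^ ν p (a C b) * u p (B e))    ≡⟨ ℤ.pos-* (p ^ ν p (a C b)) (u p (B e)) ⟩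
      + (p ^ ν p (a C b)) ℤ.* + u p (B e) ∎
      where open ≡-Reasoning

    binomialSeq-coherent : ∀ e → + B (suc e) ≡ + B e [mod p ^ e ]
    binomialSeq-coherent e = begin
      + B (suc e)                               ≡⟨ binomialSeq-unitPart (suc e) ⟩
      + (p ^ ν p (a C b)) ℤ.* + u p (B (suc e)) ≈⟨ *-congˡ-mod (+ (p ^ ν p (a C b))) (unitBinomial-coherent e) ⟩
      + (p ^ ν p (a C b)) ℤ.* + u p (B e)       ≡⟨ binomialSeq-unitPart e ⟨
      + B e                                     ∎
      where open SetoidReasoning mod-setoid

    module _ {k c : ℕ} (νd≡0 : ν p d ≡ 0)
             (valuations : (ν p a ≡ 0 × ν p b ≡ k) ⊎ (ν p a ≡ k × ν p b ≡ 0))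
             (c-choice : (ν p a ≡ k × c ≡ a) ⊎ (ν p b ≡ k × c ≡ b)) where

      binomialSeq-zSeq′ : ∀ e → + B e ℤ.* zSeq′ b e ℤ.* zSeq′ d e ≡ + (p ^ ν p (a C b)) ℤ.* negOnePow (p * c * k) ℤ.* zSeq′ a e
      binomialSeq-zSeq′ e = begin
        + B e ℤ.* (sb ℤ.* τb ℤ.* Gb) ℤ.* (sd ℤ.* τd ℤ.* Gd)
          ≡⟨ cong (λ x → x ℤ.* zSeq′ b e ℤ.* zSeq′ d e) (binomialSeq-unitPart e) ⟩
        P ℤ.* U ℤ.* (sb ℤ.* τb ℤ.* Gb) ℤ.* (sd ℤ.* τd ℤ.* Gd)
          ≡⟨ cong₂ (λ t t′ → P ℤ.* U ℤ.* (sb ℤ.* t ℤ.* Gb) ℤ.* (sd ℤ.* t′ ℤ.* Gd)) τb≡Sτa τd≡1 ⟩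
        P ℤ.* U ℤ.* (sb ℤ.* (S ℤ.* τa) ℤ.* Gb) ℤ.* (sd ℤ.* + 1 ℤ.* Gd)
          ≡⟨ lemma P U S sb sd τa Gb Gd ⟩
        P ℤ.* S ℤ.* (sb ℤ.* sd ℤ.* τa ℤ.* (U ℤ.* (Gb ℤ.* Gd)))
          ≡⟨ cong₂ (λ s g → P ℤ.* S ℤ.* (s ℤ.* τa ℤ.* g)) (negOnePow-split p e) Ga≡UGbGd ⟨
        P ℤ.* S ℤ.* (negOnePow (p * a * e) ℤ.* τa ℤ.* + unitFactorial a e) ∎
        where
        open ≡-Reasoning
        P = + (p ^ ν p (a C b))
        U = + u p (B e)
        S = negOnePow (p * c * k)
        sb = negOnePow (p * b * e)
        sd = negOnePow (p * d * e)
        τa = negOnePow (p * a * ν p a)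
        τb = negOnePow (p * b * ν p b)
        τd = negOnePow (p * d * ν p d)
        Gb = + unitFactorial b e
        Gd = + unitFactorial d e
        τb≡Sτa : τb ≡ S ℤ.* τa
        τb≡Sτa = negOnePow-valuations p valuations c-choice
        τd≡1 : τd ≡ + 1
        τd≡1 = trans (cong (λ i → negOnePow (p * d * i)) νd≡0) (negOnePow-*0 (p * d))
        Ga≡UGbGd : + unitFactorial a e ≡ U ℤ.* (Gb ℤ.* Gd)
        Ga≡UGbGd = trans (unitFactorial-binomial e) (cong (U ℤ.*_) (ℤ.pos-* (unitFactorial b e) (unitFactorial d e)))
        lemma : ∀ P U S sb sd τa Gb Gd → P ℤ.* U ℤ.* (sb ℤ.* (S ℤ.* τa) ℤ.* Gb) ℤ.* (sd ℤ.* + 1 ℤ.* Gd)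
                                       ≡ P ℤ.* S ℤ.* (sb ℤ.* sd ℤ.* τa ℤ.* (U ℤ.* (Gb ℤ.* Gd)))
        lemma = solve-∀

      binomialSeq-zSeq : ∀ e → + B e ℤ.* zSeq p b e ℤ.* zSeq p d e - + (p ^ ν p (a C b)) ℤ.* negOnePow (p * c * k) ℤ.* zSeq p a e
                               ≡ + 0 [mod p ^ e ]
      binomialSeq-zSeq e = mod-diff (begin
        + B e ℤ.* zSeq p b e ℤ.* zSeq p d e
          ≈⟨ *-cong-mod (*-congˡ-mod (+ B e) (zSeq≡zSeq′ 1≤b e)) (zSeq≡zSeq′ (ℕ.m<n⇒0<n∸m b<a) e) ⟩
        + B e ℤ.* zSeq′ b e ℤ.* zSeq′ d e
          ≡⟨ binomialSeq-zSeq′ e ⟩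
        P ℤ.* negOnePow (p * c * k) ℤ.* zSeq′ a e
          ≈⟨ *-congˡ-mod (P ℤ.* negOnePow (p * c * k)) (zSeq≡zSeq′ (ℕ.<-≤-trans (s≤s z≤n) b<a) e) ⟨
        P ℤ.* negOnePow (p * c * k) ℤ.* zSeq p a e ∎)
        where
        open SetoidReasoning mod-setoid
        P = + (p ^ ν p (a C b))

corollary1p4 : (p : ℕ) → Prime p → (a b k c : ℕ) →
    1 ≤ b → b < a → ν p (a ∸ b) ≡ 0 →
    ((ν p a ≡ 0 × ν p b ≡ k) ⊎ (ν p a ≡ k × ν p b ≡ 0)) →
    ((ν p a ≡ k × c ≡ a) ⊎ (ν p b ≡ k × c ≡ b)) →
    Σ (ℤₚ p) λ L →
      ((λ e → + ((a * p ^ e) C (b * p ^ e))) ⟶[ p ] L)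
      × PadicNull p (λ e →
          approx L e ℤ.* zSeq p b e ℤ.* zSeq p (a ∸ b) e
          - (+ (p ^ ν p (a C b))) ℤ.* negOnePow (p * c * k) ℤ.* zSeq p a e)
corollary1p4 zero          p-prime = ⊥-elim (¬prime[0] p-prime)
corollary1p4 (suc zero)    p-prime = ⊥-elim (¬prime[1] p-prime)
corollary1p4 (suc (suc p′)) p-prime a b k c 1≤b b<a νd≡0 valuations c-choice =
  coherentLimit _ coherent-B , ⟶-coherentLimit _ coherent-B ,
  padicNull (binomialSeq-zSeq p′ p-prime 1≤b b<a νd≡0 valuations c-choice)
  where coherent-B = binomialSeq-coherent p′ p-prime 1≤b b<a
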